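{- Let $M$ be a computation of $\lambda_{\copyright}$. Every sequence $M(\to^{\mathsf w}_{\sigma\beta_c})^* S$ such that $S$ is $\to^{\mathsf w}_{\beta_c}$-normal has the same number $k$ of $\beta_c$ steps. Moreover, for any such $S$: (1) the unique maximal $\to^{\mathsf w}_{\beta_c}$-sequence from $M$ has length $k$, and (2) there is a sequence $M(\to^{\mathsf w}_{\beta_c})^k L(\to^{\mathsf w}_{\sigma})^* S$ for some $L$.
   Context: The computational core $\lambda_{\copyright}$ has values $V,W ::= x \mid \lambda x.M$ and computations $M,N,L ::= \,!V \mid VM$ ($x$ ranging over a countable set of variables, terms up to $\alpha$-renaming). Rules: $\beta_c$: $(\lambda x.M)(!V) \mapsto M\{V/x\}$; $\sigma$: $(\lambda y.N)((\lambda x.M)L) \mapsto (\lambda x.(\lambda y.N)M)L$ provided $x\notin \mathrm{fv}(N)$; $\sigma\beta_c=\sigma\cup\beta_c$. Weak contexts $W ::= [\,]\mid VW$; $\to^{\mathsf w}_\rho$ is the closure of rule $\rho$ under weak contexts ($\to^{\mathsf w}_{\beta_c}$ is deterministic). $(\to)^k$ denotes exactly $k$ steps; a term is $\to$-normal if it has no $\to$-step. -}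

module Defs where

open import Data.Nat using (ℕ; zero; suc)
open import Data.Fin using (Fin; zero; suc)
open import Relation.Nullary using (¬_)

-- Terms of the computational core, well-scoped de Bruijn syntax
-- (this quotients by α-renaming). n = number of free variables in scope.
mutual
  data Val (n : ℕ) : Set where
    var : Fin n → Val n
    lam : Comp (suc n) → Val n

  data Comp (n : ℕ) : Set where
    ret : Val n → Comp n
    app : Val n → Comp n → Comp n

Ren : ℕ → ℕ → Set
Ren m n = Fin m → Fin n

liftRen : ∀ {m n} → Ren m n → Ren (suc m) (suc n)
liftRen ρ zero    = zero
liftRen ρ (suc i) = suc (ρ i)

mutual
  renV : ∀ {m n} → Ren m n → Val m → Val n
  renV ρ (var i) = var (ρ i)
  renV ρ (lam M) = lam (renC (liftRen ρ) M)

  renC : ∀ {m n} → Ren m n → Comp m → Comp n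
  renC ρ (ret V)   = ret (renV ρ V)
  renC ρ (app V M) = app (renV ρ V) (renC ρ M)

Sub : ℕ → ℕ → Set
Sub m n = Fin m → Val n

liftSub : ∀ {m n} → Sub m n → Sub (suc m) (suc n)
liftSub s zero    = var zero
liftSub s (suc i) = renV suc (s i)

mutual
  subV : ∀ {m n} → Sub m n → Val m → Val n
  subV s (var i) = s i
  subV s (lam M) = lam (subC (liftSub s) M)

  subC : ∀ {m n} → Sub m n → Comp m → Comp n
  subC s (ret V)   = ret (subV s V)
  subC s (app V M) = app (subV s V) (subC s M)

single : ∀ {n} → Val n → Sub (suc n) n
single V zero    = V
single V (suc i) = var i

_[_] : ∀ {n} → Comp (suc n) → Val n → Comp n
M [ V ] = subC (single V) M

data βc-rule {n : ℕ} : Comp n → Comp n → Set where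
  βc : (M : Comp (suc n)) (V : Val n) → βc-rule (app (lam M) (ret V)) (M [ V ])

-- σ : (λy.N)((λx.M)L) ↦ (λx.(λy.N)M)L, with x ∉ fv(N):
-- under the new binder x, λy.N is weakened (x is fresh for it).
data σ-rule {n : ℕ} : Comp n → Comp n → Set where
  σ : (N : Comp (suc n)) (M : Comp (suc n)) (L : Comp n) →
      σ-rule (app (lam N) (app (lam M) L))
             (app (lam (app (renV suc (lam N)) M)) L)

data Weak (R : ∀ {n} → Comp n → Comp n → Set) {n : ℕ} : Comp n → Comp n → Set where
  root : ∀ {M N} → R M N → Weak R M N
  ctx  : ∀ {M N} (V : Val n) → Weak R M N → Weak R (app V M) (app V N)

_→wβ_ : ∀ {n} → Comp n → Comp n → Set
_→wβ_ = Weak βc-rule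

_→wσ_ : ∀ {n} → Comp n → Comp n → Set
_→wσ_ = Weak σ-rule

data Steps {n : ℕ} (R : Comp n → Comp n → Set) : ℕ → Comp n → Comp n → Set where
  done : ∀ {M} → Steps R zero M M
  step : ∀ {k M N L} → R M N → Steps R k N L → Steps R (suc k) M L

data Star {n : ℕ} (R : Comp n → Comp n → Set) : Comp n → Comp n → Set where
  done : ∀ {M} → Star R M M
  step : ∀ {M N L} → R M N → Star R N L → Star R M L

data SeqSB {n : ℕ} : Comp n → ℕ → Comp n → Set where
  done  : ∀ {M} → SeqSB M zero M
  stepβ : ∀ {k M N L} → M →wβ N → SeqSB N k L → SeqSB M (suc k) L
  stepσ : ∀ {k M N L} → M →wσ N → SeqSB N k L → SeqSB M k L

Normal : ∀ {n} → (Comp n → Comp n → Set) → Comp n → Set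
Normal R S = ∀ N → ¬ R S N

-- A σ-step followed by a weak βc-step can be replaced by one weak βc-step followed by
-- at most one σ-step, so every σβc-sequence M →* S with k βc-steps can be rearranged
-- into M →βc^k L →σ* S. A σ-step never destroys a weak βc-redex, hence L is βc-normal
-- whenever S is; and since weak βc-reduction is deterministic, the length of a βc-sequence
-- ending in a βc-normal form is fixed, which gives all three claims.
module Submission where

open import Defs
open import Data.Nat using (ℕ; suc)
open import Data.Fin using (zero; suc)
open import Data.Product using (_×_; ∃-syntax; _,_)
open import Data.Empty using (⊥-elim)
open import Relation.Binary.PropositionalEquality using (_≡_; refl; cong; cong₂; subst; sym)
open import Relation.Binary.Rewriting using (Deterministic)

mutual
  subV-renV-inverse : ∀ {m n} (ρ : Ren m n) (s : Sub n m) → (∀ i → s (ρ i) ≡ var i) →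
                      (W : Val m) → subV s (renV ρ W) ≡ W
  subV-renV-inverse ρ s s∘ρ≡var (var i) = s∘ρ≡var i
  subV-renV-inverse ρ s s∘ρ≡var (lam M) =
    cong lam (subC-renC-inverse (liftRen ρ) (liftSub s) lifted M)
    where
    lifted : ∀ i → liftSub s (liftRen ρ i) ≡ var i
    lifted zero    = refl
    lifted (suc i) = cong (renV suc) (s∘ρ≡var i)

  subC-renC-inverse : ∀ {m n} (ρ : Ren m n) (s : Sub n m) → (∀ i → s (ρ i) ≡ var i) →
                      (M : Comp m) → subC s (renC ρ M) ≡ M
  subC-renC-inverse ρ s s∘ρ≡var (ret V)   = cong ret (subV-renV-inverse ρ s s∘ρ≡var V)
  subC-renC-inverse ρ s s∘ρ≡var (app V M) =
    cong₂ app (subV-renV-inverse ρ s s∘ρ≡var V) (subC-renC-inverse ρ s s∘ρ≡var M)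

single-weaken : ∀ {n} (V W : Val n) → subV (single V) (renV suc W) ≡ W
single-weaken V = subV-renV-inverse suc (single V) (λ _ → refl)

Star-++ : ∀ {n} {R : Comp n → Comp n → Set} {A B C : Comp n} →
          Star R A B → Star R B C → Star R A C
Star-++ done         t = t
Star-++ (step r s) t = step r (Star-++ s t)

Star-ctx : ∀ {n} {R : ∀ {m} → Comp m → Comp m → Set} (V : Val n) {A B : Comp n} →
           Star (Weak R) A B → Star (Weak R) (app V A) (app V B)
Star-ctx V done       = done
Star-ctx V (step r s) = step (ctx V r) (Star-ctx V s)

→wβ-deterministic : ∀ {n} → Deterministic _≡_ (_→wβ_ {n})
→wβ-deterministic (root (βc M V)) (root (βc .M .V)) = refl
→wβ-deterministic (root (βc M V)) (ctx _ (root ()))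
→wβ-deterministic (ctx V (root ())) (root (βc _ _))
→wβ-deterministic (ctx V r) (ctx .V r′) = cong (app V) (→wβ-deterministic r r′)

Steps-normal-length-unique : ∀ {n} {R : Comp n → Comp n → Set} → Deterministic _≡_ R →
  ∀ {j k} {M L L′ : Comp n} →
  Steps R j M L → Normal R L → Steps R k M L′ → Normal R L′ → j ≡ k
Steps-normal-length-unique det done nL done nL′ = refl
Steps-normal-length-unique det done nL (step r _) nL′ = ⊥-elim (nL _ r)
Steps-normal-length-unique det (step r _) nL done nL′ = ⊥-elim (nL′ _ r)
Steps-normal-length-unique det (step r s) nL (step r′ s′) nL′ with det r r′
... | refl = cong suc (Steps-normal-length-unique det s nL s′ nL′)

σβ-postpone : ∀ {n} {M N P : Comp n} → M →wσ N → N →wβ P →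
              ∃[ Q ] (M →wβ Q × Star _→wσ_ Q P)
σβ-postpone (root (σ N M .(ret V))) (root (βc _ V)) =
  app (lam N) (M [ V ]) , ctx (lam N) (root (βc M V)) , weakened-redex-contracted
  where
  weakened-redex-contracted :
    Star _→wσ_ (app (lam N) (M [ V ])) (app (subV (single V) (renV suc (lam N))) (M [ V ]))
  weakened-redex-contracted =
    subst (λ W → Star _→wσ_ (app (lam N) (M [ V ])) (app W (M [ V ])))
          (sym (single-weaken V (lam N))) done
σβ-postpone (root (σ N M L)) (ctx _ r) =
  _ , ctx (lam N) (ctx (lam M) r) , step (root (σ N M _)) done
σβ-postpone (ctx V (root ())) (root (βc _ _))
σβ-postpone (ctx V (ctx _ _)) (root ())
σβ-postpone (ctx V r) (ctx .V r′) with σβ-postpone r r′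
... | Q , β , σs = app V Q , ctx V β , Star-ctx V σs

σ*β-postpone : ∀ {n} {M N P : Comp n} → Star _→wσ_ M N → N →wβ P →
               ∃[ Q ] (M →wβ Q × Star _→wσ_ Q P)
σ*β-postpone done       β = _ , β , done
σ*β-postpone (step r s) β with σ*β-postpone s β
... | _ , β₁ , σs₁ with σβ-postpone r β₁
... | Q , β₂ , σs₂ = Q , β₂ , Star-++ σs₂ σs₁

σ*βᵏ-postpone : ∀ {n} {k} {M N P : Comp n} → Star _→wσ_ M N → Steps _→wβ_ k N P →
                ∃[ Q ] (Steps _→wβ_ k M Q × Star _→wσ_ Q P)
σ*βᵏ-postpone σs done       = _ , done , σs
σ*βᵏ-postpone σs (step β t) with σ*β-postpone σs β
... | _ , β₁ , σs₁ with σ*βᵏ-postpone σs₁ t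
... | Q , βs , σs₂ = Q , step β₁ βs , σs₂

SeqSB⇒βᵏσ* : ∀ {n} {k} {M S : Comp n} → SeqSB M k S →
             ∃[ L ] (Steps _→wβ_ k M L × Star _→wσ_ L S)
SeqSB⇒βᵏσ* done = _ , done , done
SeqSB⇒βᵏσ* (stepβ β q) with SeqSB⇒βᵏσ* q
... | L , βs , σs = L , step β βs , σs
SeqSB⇒βᵏσ* (stepσ r q) with SeqSB⇒βᵏσ* q
... | _ , βs , σs with σ*βᵏ-postpone (step r done) βs
... | L , βs′ , σs′ = L , βs′ , Star-++ σs′ σs

σ-preserves-β-redex : ∀ {n} {M N P : Comp n} → M →wσ N → M →wβ P → ∃[ P′ ] (N →wβ P′)
σ-preserves-β-redex (root (σ _ _ _)) (root ())
σ-preserves-β-redex (root (σ _ _ .(ret V))) (ctx _ (root (βc _ V))) = _ , root (βc _ V)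
σ-preserves-β-redex (root (σ _ _ _)) (ctx _ (ctx _ β)) = _ , ctx _ β
σ-preserves-β-redex (ctx V (root ())) (root (βc _ _))
σ-preserves-β-redex (ctx V r) (ctx .V β) with σ-preserves-β-redex r β
... | P′ , β′ = app V P′ , ctx V β′

σ*-reflects-β-normal : ∀ {n} {L S : Comp n} → Star _→wσ_ L S →
                       Normal _→wβ_ S → Normal _→wβ_ L
σ*-reflects-β-normal done       nS = nS
σ*-reflects-β-normal (step r s) nS _ β with σ-preserves-β-redex r β
... | P′ , β′ = σ*-reflects-β-normal s nS P′ β′

SeqSB⇒βᵏ-normal : ∀ {n} {k} {M S : Comp n} → SeqSB M k S → Normal _→wβ_ S →
                  ∃[ L ] (Steps _→wβ_ k M L × Normal _→wβ_ L)
SeqSB⇒βᵏ-normal q nS with SeqSB⇒βᵏσ* q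
... | L , βs , σs = L , βs , σ*-reflects-β-normal σs nS

βᵏ-normal-length-unique : ∀ {n} {j k} {M L L′ : Comp n} →
  Steps _→wβ_ j M L → Normal _→wβ_ L → Steps _→wβ_ k M L′ → Normal _→wβ_ L′ → j ≡ k
βᵏ-normal-length-unique = Steps-normal-length-unique →wβ-deterministic

mainTheorem18 : ∀ {n} (M : Comp n) →
    ((S S′ : Comp n) (k k′ : ℕ) →
       SeqSB M k S → Normal _→wβ_ S →
       SeqSB M k′ S′ → Normal _→wβ_ S′ → k ≡ k′)
    × ((S : Comp n) (k : ℕ) → SeqSB M k S → Normal _→wβ_ S →
         (∃[ L ] (Steps _→wβ_ k M L × Normal _→wβ_ L))
         × ((j : ℕ) (L : Comp n) → Steps _→wβ_ j M L → Normal _→wβ_ L → j ≡ k)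
         × (∃[ L ] (Steps _→wβ_ k M L × Star _→wσ_ L S)))
mainTheorem18 M =
  (λ S S′ k k′ q nS q′ nS′ →
     let _ , βs  , nL  = SeqSB⇒βᵏ-normal q nS
         _ , βs′ , nL′ = SeqSB⇒βᵏ-normal q′ nS′
     in βᵏ-normal-length-unique βs nL βs′ nL′)
  , λ S k q nS →
      let L , βs , nL = SeqSB⇒βᵏ-normal q nS
      in (L , βs , nL)
       , (λ j L′ βs′ nL′ → βᵏ-normal-length-unique βs′ nL′ βs nL)
       , SeqSB⇒βᵏσ* q
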